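{- For every $n\ge 1$, the number of intervals $[v,w]$ (with $v\le w$) in the middle order $\mathcal{P}_n$ is $\prod_{i=0}^{n-1}\binom{i+2}{2}=\frac{n!\,(n+1)!}{2^n}$.
   Context: For $w\in S_n$ (one-line notation), its inversion sequence is $I(w)=(x_1,\ldots,x_n)$ with $x_i=\#\{j<i : w^{ -1}(j)>w^{ -1}(i)\}$. The middle order $\mathcal{P}_n$ is the poset on $S_n$ with $v\le w$ iff $I(v)\le I(w)$ coordinate-wise. -}

module Defs where

open import Data.Nat using (ℕ; zero; suc; _*_; _+_; _^_; _≤ᵇ_)
open import Data.Nat.Combinatorics using (_C_)
open import Data.Nat.ListAction using (product)
open import Data.Fin using (Fin; toℕ; _≟_; _<?_)
open import Data.Vec using (Vec; []; _∷_; lookup)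
open import Data.List using (List; []; _∷_; length; filter; concatMap; map; cartesianProduct; allFin; upTo)
open import Data.Bool using (Bool; true; false; _∧_; _∨_; not; T?)
open import Data.Bool.ListAction using (all)
open import Data.Product using (_×_; _,_)
open import Relation.Nullary.Decidable using (⌊_⌋)

-- A word of length n over the alphabet Fin n (one-line notation; values are
-- 0,…,n-1 instead of 1,…,n, positions are also 0-indexed).
Word : ℕ → Set
Word n = Vec (Fin n) n

allWords : (n k : ℕ) → List (Vec (Fin n) k)
allWords n zero    = [] ∷ []
allWords n (suc k) = concatMap (λ ws → map (λ a → a ∷ ws) (allFin n)) (allWords n k)

isPerm : ∀ {n} → Word n → Bool
isPerm {n} w =
  all (λ p → all (λ q → ⌊ p ≟ q ⌋ ∨ not ⌊ lookup w p ≟ lookup w q ⌋) (allFin n)) (allFin n)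

Sym : (n : ℕ) → List (Word n)
Sym n = filter (λ w → T? (isPerm w)) (allWords n n)

firstOr : ∀ {A : Set} → A → (A → Bool) → List A → A
firstOr d t []       = d
firstOr d t (x ∷ xs) with t x
... | true  = x
... | false = firstOr d t xs

-- w⁻¹(i): the position at which the value i occurs in w
-- (for a permutation w this position exists and is unique).
inv : ∀ {n} → Word n → Fin n → Fin n
inv {n} w i = firstOr i (λ p → ⌊ lookup w p ≟ i ⌋) (allFin n)

invSeq : ∀ {n} → Word n → Fin n → ℕ
invSeq {n} w i = length (filter (λ j → T? (⌊ j <? i ⌋ ∧ ⌊ inv w i <? inv w j ⌋)) (allFin n))

middle≤ᵇ : ∀ {n} → Word n → Word n → Bool
middle≤ᵇ {n} v w = all (λ i → invSeq v i ≤ᵇ invSeq w i) (allFin n)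

numIntervals : ℕ → ℕ
numIntervals n =
  length (filter (λ vw → T? (middle≤ᵇ (Data.Product.proj₁ vw) (Data.Product.proj₂ vw)))
                 (cartesianProduct (Sym n) (Sym n)))
  where import Data.Product

binomProduct : ℕ → ℕ
binomProduct n = product (map (λ i → (i + 2) C 2) (upTo n))

module Submission where

-- The map w ↦ I(w) is a bijection from S_n onto the sequences x with 0 ≤ x_i ≤ i: the inverse
-- builds w⁻¹ by inserting the values 0, 1, …, n-1 one at a time, value i at the position that
-- leaves exactly x_i of the earlier values to its right. The middle order is the coordinatewise
-- order on these sequences, so the intervals of P_n are the pairs x ≤ y of such sequences, and
-- their number factors over the coordinates: coordinate i contributes #{(a, c) : a ≤ c ≤ i},
-- which is C(i+2, 2). Since 2 C(i+2, 2) = (i+2)(i+1), the product telescopes to n! (n+1)! / 2ⁿ.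

open import Defs
open import Data.Bool using (Bool; true; false; T; T?; if_then_else_; _∧_; _∨_; not)
open import Data.Bool.ListAction using (all)
open import Data.Empty using (⊥-elim)
open import Data.Fin as Fin using (Fin; toℕ; fromℕ<; punchOut) renaming (_≟_ to _≟ᶠ_; _<?_ to _<?ᶠ_)
open import Data.Fin.Properties
  using (toℕ-injective; toℕ<n; fromℕ<-toℕ; toℕ-fromℕ<; any?; punchOut-injective; injective⇒≤)
open import Data.List
  using (List; []; _∷_; _++_; length; filter; map; concat; concatMap; cartesianProduct; tabulate; allFin; applyUpTo; downFrom)
open import Data.List.Membership.Propositional using (_∈_)
open import Data.List.Membership.Propositional.Properties using (∈-allFin)
open import Data.List.Relation.Unary.All as All using (All; []; _∷_)
open import Data.List.Relation.Unary.All.Properties using (all⁺; all⁻; concat⁺; map⁺; applyDownFrom⁺₁)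
open import Data.List.Relation.Unary.Any using (here; there)
open import Data.Nat
  using (ℕ; zero; suc; _+_; _*_; _∸_; _^_; _!; _≤_; _<_; _≥_; z≤n; s≤s; z<s; s<s; _≤ᵇ_; _<ᵇ_; _≡ᵇ_)
open import Data.Nat.Combinatorics using (_C_; nCk+nC[k+1]≡[n+1]C[k+1]; nC1≡n)
open import Data.Nat.ListAction using (product)
open import Data.Nat.Properties
open import Algebra.Properties.CommutativeSemigroup +-commutativeSemigroup using (interchange)
open import Data.Nat.Tactic.RingSolver using (solve-∀)
open import Data.Product using (∃; _×_; _,_; proj₁; proj₂)
open import Data.Sum using (inj₁; inj₂)
open import Data.Unit using (tt)
open import Data.Vec as Vec using (Vec; []; _∷_; lookup)
open import Data.Vec.Properties using (≡-dec; lookup∘tabulate; tabulate∘lookup; tabulate-cong)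
open import Function using (_∘_)
open import Relation.Binary using (tri<; tri≈; tri>)
open import Relation.Binary.Definitions using (DecidableEquality)
open import Relation.Binary.PropositionalEquality
open import Relation.Nullary using (yes; no; does)
open import Relation.Nullary.Decidable using (⌊_⌋; isYes≗does; toWitness; fromWitness; dec-true; dec-false)

𝟙 : Bool → ℕ
𝟙 true  = 1
𝟙 false = 0

𝟙-≤1 : ∀ b → 𝟙 b ≤ 1
𝟙-≤1 true  = ≤-refl
𝟙-≤1 false = z≤n

𝟙-mono : ∀ {a b} → (T a → T b) → 𝟙 a ≤ 𝟙 b
𝟙-mono {false}         _ = z≤n
𝟙-mono {true} {true}   _ = ≤-refl
𝟙-mono {true} {false}  h = ⊥-elim (h tt)

𝟙-∧ : ∀ a b → 𝟙 (a ∧ b) ≡ 𝟙 a * 𝟙 b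
𝟙-∧ true  b = sym (+-identityʳ (𝟙 b))
𝟙-∧ false b = refl

-- _<ᵇ_, _≤ᵇ_ and _≡ᵇ_ are definitionally the `does` fields of _<?_, _≤?_ and _≟_.
<ᵇ-true : ∀ {a b} → a < b → (a <ᵇ b) ≡ true
<ᵇ-true {a} {b} = dec-true (a <? b)

<ᵇ-false : ∀ {a b} → b ≤ a → (a <ᵇ b) ≡ false
<ᵇ-false {a} {b} b≤a = dec-false (a <? b) (≤⇒≯ b≤a)

≤ᵇ-true : ∀ {a b} → a ≤ b → (a ≤ᵇ b) ≡ true
≤ᵇ-true {a} {b} = dec-true (a ≤? b)

≤ᵇ-false : ∀ {a b} → b < a → (a ≤ᵇ b) ≡ false
≤ᵇ-false {a} {b} b<a = dec-false (a ≤? b) (<⇒≱ b<a)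

≡ᵇ-refl : ∀ a → (a ≡ᵇ a) ≡ true
≡ᵇ-refl a = dec-true (a ≟ a) refl

≡ᵇ-false : ∀ {a b} → a ≢ b → (a ≡ᵇ b) ≡ false
≡ᵇ-false {a} {b} = dec-false (a ≟ b)

sum< : (ℕ → ℕ) → ℕ → ℕ
sum< f zero    = 0
sum< f (suc m) = f 0 + sum< (f ∘ suc) m

count< : (ℕ → Bool) → ℕ → ℕ
count< P = sum< (𝟙 ∘ P)

sum<-snoc : ∀ f m → sum< f (suc m) ≡ sum< f m + f m
sum<-snoc f zero    = +-comm (f 0) 0
sum<-snoc f (suc m) =
  trans (cong (f 0 +_) (sum<-snoc (f ∘ suc) m)) (sym (+-assoc (f 0) _ (f (suc m))))

sum<-cong : ∀ {f g} m → (∀ {k} → k < m → f k ≡ g k) → sum< f m ≡ sum< g m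
sum<-cong zero    f≗g = refl
sum<-cong (suc m) f≗g = cong₂ _+_ (f≗g z<s) (sum<-cong m (f≗g ∘ s<s))

sum<-+ : ∀ f g m → sum< (λ k → f k + g k) m ≡ sum< f m + sum< g m
sum<-+ f g zero    = refl
sum<-+ f g (suc m) =
  trans (cong (f 0 + g 0 +_) (sum<-+ (f ∘ suc) (g ∘ suc) m)) (interchange (f 0) (g 0) _ _)

sum<-zero : ∀ m → sum< (λ _ → 0) m ≡ 0
sum<-zero zero    = refl
sum<-zero (suc m) = sum<-zero m

sum<-const : ∀ c m → sum< (λ _ → c) m ≡ m * c
sum<-const c zero    = refl
sum<-const c (suc m) = cong (c +_) (sum<-const c m)

sum<-mono-≤ : ∀ {f g} m → (∀ {k} → k < m → f k ≤ g k) → sum< f m ≤ sum< g m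
sum<-mono-≤ zero    f≤g = z≤n
sum<-mono-≤ (suc m) f≤g = +-mono-≤ (f≤g z<s) (sum<-mono-≤ m (f≤g ∘ s<s))

sum<-mono-< : ∀ {f g} m → (∀ {k} → k < m → f k ≤ g k) →
              ∀ {i} → i < m → f i < g i → sum< f m < sum< g m
sum<-mono-< (suc m) f≤g {zero}  _         fi<gi = +-mono-<-≤ fi<gi (sum<-mono-≤ m (f≤g ∘ s<s))
sum<-mono-< (suc m) f≤g {suc i} (s<s i<m) fi<gi =
  +-mono-≤-< (f≤g z<s) (sum<-mono-< m (f≤g ∘ s<s) i<m fi<gi)

count<-≤ : ∀ P m → count< P m ≤ m
count<-≤ P zero    = z≤n
count<-≤ P (suc m) = +-mono-≤ (𝟙-≤1 (P 0)) (count<-≤ (P ∘ suc) m)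

count<-mono-≤ : ∀ {P Q} m → (∀ {k} → k < m → T (P k) → T (Q k)) → count< P m ≤ count< Q m
count<-mono-≤ m P⇒Q = sum<-mono-≤ m (𝟙-mono ∘ P⇒Q)

count<-mono-< : ∀ {P Q} m → (∀ {k} → k < m → T (P k) → T (Q k)) →
                ∀ {i} → i < m → P i ≡ false → Q i ≡ true → count< P m < count< Q m
count<-mono-< m P⇒Q i<m Pi Qi =
  sum<-mono-< m (𝟙-mono ∘ P⇒Q) i<m (subst₂ (λ p q → 𝟙 p < 𝟙 q) (sym Pi) (sym Qi) z<s)

count<-complement : ∀ P Q m → (∀ {k} → k < m → 𝟙 (P k) + 𝟙 (Q k) ≡ 1) →
                    count< P m + count< Q m ≡ m
count<-complement P Q m exactlyOne = begin
  count< P m + count< Q m           ≡⟨ sum<-+ (𝟙 ∘ P) (𝟙 ∘ Q) m ⟨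
  sum< (λ k → 𝟙 (P k) + 𝟙 (Q k)) m  ≡⟨ sum<-cong m exactlyOne ⟩
  sum< (λ _ → 1) m                  ≡⟨ sum<-const 1 m ⟩
  m * 1                             ≡⟨ *-identityʳ m ⟩
  m                                 ∎
  where open ≡-Reasoning

count<-≡ᵇ : ∀ {j} m → j < m → count< (_≡ᵇ j) m ≡ 1
count<-≡ᵇ {zero}  (suc m) _         = cong suc (sum<-zero m)
count<-≡ᵇ {suc j} (suc m) (s<s j<m) = count<-≡ᵇ m j<m

-- The insertion construction

-- The ℕ-analogue of Data.Fin.punchIn: the point q is skipped.
punchIn : ℕ → ℕ → ℕ
punchIn q a = if a <ᵇ q then a else suc a

punchIn-< : ∀ {q a} → a < q → punchIn q a ≡ a
punchIn-< a<q rewrite <ᵇ-true a<q = refl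

punchIn-≥ : ∀ {q a} → q ≤ a → punchIn q a ≡ suc a
punchIn-≥ q≤a rewrite <ᵇ-false q≤a = refl

punchIn≢ : ∀ q a → punchIn q a ≢ q
punchIn≢ q a with a <? q
... | yes a<q rewrite punchIn-< a<q = <⇒≢ a<q
... | no  a≮q rewrite punchIn-≥ (≮⇒≥ a≮q) = ≢-sym (<⇒≢ (s≤s (≮⇒≥ a≮q)))

punchIn-injective : ∀ q {a b} → punchIn q a ≡ punchIn q b → a ≡ b
punchIn-injective q {a} {b} eq with a <? q | b <? q
... | yes a<q | yes b<q rewrite punchIn-< a<q | punchIn-< b<q = eq
... | yes a<q | no  b≮q rewrite punchIn-< a<q | punchIn-≥ (≮⇒≥ b≮q) =
  ⊥-elim (<⇒≱ a<q (≤-trans (≮⇒≥ b≮q) (subst (b ≤_) (sym eq) (n≤1+n b))))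
... | no  a≮q | yes b<q rewrite punchIn-≥ (≮⇒≥ a≮q) | punchIn-< b<q =
  ⊥-elim (<⇒≱ b<q (≤-trans (≮⇒≥ a≮q) (subst (a ≤_) eq (n≤1+n a))))
... | no  a≮q | no  b≮q rewrite punchIn-≥ (≮⇒≥ a≮q) | punchIn-≥ (≮⇒≥ b≮q) = suc-injective eq

punchIn-<ᵇ : ∀ q a b → (punchIn q a <ᵇ punchIn q b) ≡ (a <ᵇ b)
punchIn-<ᵇ q a b with a <? q | b <? q
... | yes a<q | yes b<q rewrite punchIn-< a<q | punchIn-< b<q = refl
... | yes a<q | no  b≮q rewrite punchIn-< a<q | punchIn-≥ (≮⇒≥ b≮q) =
  trans (<ᵇ-true (m<n⇒m<1+n a<b)) (sym (<ᵇ-true a<b))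
  where a<b = <-≤-trans a<q (≮⇒≥ b≮q)
... | no  a≮q | yes b<q rewrite punchIn-≥ (≮⇒≥ a≮q) | punchIn-< b<q =
  trans (<ᵇ-false (m≤n⇒m≤1+n b≤a)) (sym (<ᵇ-false b≤a))
  where b≤a = ≤-trans (<⇒≤ b<q) (≮⇒≥ a≮q)
... | no  a≮q | no  b≮q rewrite punchIn-≥ (≮⇒≥ a≮q) | punchIn-≥ (≮⇒≥ b≮q) = refl

<ᵇ-punchIn : ∀ q a → (q <ᵇ punchIn q a) ≡ (q ≤ᵇ a)
<ᵇ-punchIn q a with a <? q
... | yes a<q rewrite punchIn-< a<q = trans (<ᵇ-false (<⇒≤ a<q)) (sym (≤ᵇ-false a<q))
... | no  a≮q rewrite punchIn-≥ (≮⇒≥ a≮q) =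
  trans (<ᵇ-true (s≤s (≮⇒≥ a≮q))) (sym (≤ᵇ-true (≮⇒≥ a≮q)))

≤ᵇ-punchIn-below : ∀ {v q} a → v ≤ q → (v ≤ᵇ punchIn q a) ≡ (v ≤ᵇ a)
≤ᵇ-punchIn-below {v} {q} a v≤q with a <? q
... | yes a<q rewrite punchIn-< a<q = refl
... | no  a≮q rewrite punchIn-≥ (≮⇒≥ a≮q) =
  trans (≤ᵇ-true (m≤n⇒m≤1+n v≤a)) (sym (≤ᵇ-true v≤a))
  where v≤a = ≤-trans v≤q (≮⇒≥ a≮q)

≤ᵇ-punchIn-above : ∀ {v q} a → q ≤ v → (suc v ≤ᵇ punchIn q a) ≡ (v ≤ᵇ a)
≤ᵇ-punchIn-above {v} {q} a q≤v with a <? q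
... | yes a<q rewrite punchIn-< a<q =
  trans (≤ᵇ-false (m<n⇒m<1+n a<v)) (sym (≤ᵇ-false a<v))
  where a<v = <-≤-trans a<q q≤v
... | no  a≮q rewrite punchIn-≥ (≮⇒≥ a≮q) with v ≤? a
...   | yes v≤a = trans (≤ᵇ-true (s≤s v≤a)) (sym (≤ᵇ-true v≤a))
...   | no  v≰a = trans (≤ᵇ-false (s≤s (≰⇒> v≰a))) (sym (≤ᵇ-false (≰⇒> v≰a)))

-- With x k read as the number of j < k with w⁻¹ j > w⁻¹ k, this computes w⁻¹ on values < m:
-- value k is inserted at position k ∸ x k, to the left of exactly x k of the k values before it.
position : (ℕ → ℕ) → ℕ → ℕ → ℕ
position x zero    i = 0
position x (suc m) i = if i ≡ᵇ m then m ∸ x m else punchIn (m ∸ x m) (position x m i)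

inversions : (ℕ → ℕ) → ℕ → ℕ
inversions s k = count< (λ j → s k <ᵇ s j) k

position-new : ∀ x m → position x (suc m) m ≡ m ∸ x m
position-new x m rewrite ≡ᵇ-refl m = refl

position-old : ∀ x {m i} → i < m → position x (suc m) i ≡ punchIn (m ∸ x m) (position x m i)
position-old x i<m rewrite ≡ᵇ-false (<⇒≢ i<m) = refl

position-cong : ∀ {x y} m → (∀ {k} → k < m → x k ≡ y k) → ∀ i → position x m i ≡ position y m i
position-cong zero    x≗y i = refl
position-cong (suc m) x≗y i
  rewrite x≗y (n<1+n m) | position-cong m (x≗y ∘ m<n⇒m<1+n) i = refl

position-< : ∀ x {m i} → i < m → position x m i < m
position-< x {suc m} {i} i<1+m with m<1+n⇒m<n∨m≡n i<1+m
... | inj₂ refl rewrite position-new x m = s≤s (m∸n≤m m (x m))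
... | inj₁ i<m rewrite position-old x i<m with position x m i <? m ∸ x m
...   | yes p<q rewrite punchIn-< p<q  = ≤-trans p<q (m≤n⇒m≤1+n (m∸n≤m m (x m)))
...   | no  p≮q rewrite punchIn-≥ (≮⇒≥ p≮q) = s≤s (position-< x i<m)

position-injective : ∀ x {m i j} → i < m → j < m → position x m i ≡ position x m j → i ≡ j
position-injective x {suc m} i<1+m j<1+m eq
  with m<1+n⇒m<n∨m≡n i<1+m | m<1+n⇒m<n∨m≡n j<1+m
... | inj₂ refl | inj₂ refl = refl
... | inj₂ refl | inj₁ j<m rewrite position-new x m | position-old x j<m =
  ⊥-elim (punchIn≢ (m ∸ x m) _ (sym eq))
... | inj₁ i<m | inj₂ refl rewrite position-new x m | position-old x i<m =
  ⊥-elim (punchIn≢ (m ∸ x m) _ eq)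
... | inj₁ i<m | inj₁ j<m rewrite position-old x i<m | position-old x j<m =
  position-injective x i<m j<m (punchIn-injective (m ∸ x m) eq)

position-surjective : ∀ x {m v} → v < m → ∃ λ j → j < m × position x m j ≡ v
position-surjective x {suc m} {v} v<1+m with <-cmp v (m ∸ x m)
... | tri≈ _ refl _ = m , ≤-refl , position-new x m
... | tri< v<q _ _ with position-surjective x (<-≤-trans v<q (m∸n≤m m (x m)))
...   | j , j<m , eq = j , m<n⇒m<1+n j<m ,
        trans (position-old x j<m) (trans (cong (punchIn (m ∸ x m)) eq) (punchIn-< v<q))
position-surjective x {suc m} {suc v} (s<s v<m) | tri> _ _ q<1+v with position-surjective x v<m
...   | j , j<m , eq = j , m<n⇒m<1+n j<m ,
        trans (position-old x j<m) (trans (cong (punchIn (m ∸ x m)) eq) (punchIn-≥ (<⇒≤pred q<1+v)))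

count-position-≥ : ∀ x m v → count< (λ j → v ≤ᵇ position x m j) m ≡ m ∸ v
count-position-≥ x zero    v = sym (0∸n≡0 v)
count-position-≥ x (suc m) v with v ≤? m ∸ x m
... | yes v≤q = begin
  count< (λ j → v ≤ᵇ position x (suc m) j) (suc m)
    ≡⟨ sum<-snoc _ m ⟩
  count< (λ j → v ≤ᵇ position x (suc m) j) m + 𝟙 (v ≤ᵇ position x (suc m) m)
    ≡⟨ cong₂ _+_ (sum<-cong m λ j<m → cong 𝟙 (trans (cong (v ≤ᵇ_) (position-old x j<m))
                                                      (≤ᵇ-punchIn-below _ v≤q)))
                 (cong (λ p → 𝟙 (v ≤ᵇ p)) (position-new x m)) ⟩
  count< (λ j → v ≤ᵇ position x m j) m + 𝟙 (v ≤ᵇ m ∸ x m)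
    ≡⟨ cong₂ _+_ (count-position-≥ x m v) (cong 𝟙 (≤ᵇ-true v≤q)) ⟩
  m ∸ v + 1
    ≡⟨ +-∸-comm 1 (≤-trans v≤q (m∸n≤m m (x m))) ⟨
  m + 1 ∸ v
    ≡⟨ cong (_∸ v) (+-comm m 1) ⟩
  suc m ∸ v ∎
  where open ≡-Reasoning
... | no v≰q with ≰⇒> v≰q
...   | q<v@(s≤s {n = v′} q≤v′) = begin
  count< (λ j → suc v′ ≤ᵇ position x (suc m) j) (suc m)
    ≡⟨ sum<-snoc _ m ⟩
  count< (λ j → suc v′ ≤ᵇ position x (suc m) j) m + 𝟙 (suc v′ ≤ᵇ position x (suc m) m)
    ≡⟨ cong₂ _+_ (sum<-cong m λ j<m → cong 𝟙 (trans (cong (suc v′ ≤ᵇ_) (position-old x j<m))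
                                                      (≤ᵇ-punchIn-above _ q≤v′)))
                 (cong (λ p → 𝟙 (suc v′ ≤ᵇ p)) (position-new x m)) ⟩
  count< (λ j → v′ ≤ᵇ position x m j) m + 𝟙 (suc v′ ≤ᵇ m ∸ x m)
    ≡⟨ cong₂ _+_ (count-position-≥ x m v′) (cong 𝟙 (≤ᵇ-false q<v)) ⟩
  m ∸ v′ + 0
    ≡⟨ +-identityʳ (m ∸ v′) ⟩
  suc m ∸ suc v′ ∎
  where open ≡-Reasoning

position-<ᵇ-stable : ∀ x {m i j} d → i < m → j < m →
  (position x (d + m) i <ᵇ position x (d + m) j) ≡ (position x m i <ᵇ position x m j)
position-<ᵇ-stable x         zero    i<m j<m = refl
position-<ᵇ-stable x {m} {i} {j} (suc d) i<m j<m = begin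
  (position x (suc d + m) i <ᵇ position x (suc d + m) j)
    ≡⟨ cong₂ _<ᵇ_ (position-old x (≤-trans i<m (m≤n+m m d))) (position-old x (≤-trans j<m (m≤n+m m d))) ⟩
  (punchIn q (position x (d + m) i) <ᵇ punchIn q (position x (d + m) j))
    ≡⟨ punchIn-<ᵇ q _ _ ⟩
  (position x (d + m) i <ᵇ position x (d + m) j)
    ≡⟨ position-<ᵇ-stable x d i<m j<m ⟩
  (position x m i <ᵇ position x m j) ∎
  where open ≡-Reasoning
        q = d + m ∸ x (d + m)

inversions-position : ∀ x {n i} → i < n → x i ≤ i → inversions (position x n) i ≡ x i
inversions-position x {n} {i} i<n xi≤i =
  subst (λ n → inversions (position x n) i ≡ x i) (m∸n+n≡m i<n) (atTime (n ∸ suc i))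
  where
  atTime : ∀ d → inversions (position x (d + suc i)) i ≡ x i
  atTime d = begin
    count< (λ j → position x (d + suc i) i <ᵇ position x (d + suc i) j) i
      ≡⟨ sum<-cong i (λ j<i → cong 𝟙 (position-<ᵇ-stable x d (n<1+n i) (m<n⇒m<1+n j<i))) ⟩
    count< (λ j → position x (suc i) i <ᵇ position x (suc i) j) i
      ≡⟨ sum<-cong i (λ j<i → cong 𝟙 (trans (cong₂ _<ᵇ_ (position-new x i) (position-old x j<i))
                                            (<ᵇ-punchIn (i ∸ x i) _))) ⟩
    count< (λ j → i ∸ x i ≤ᵇ position x i j) i
      ≡⟨ count-position-≥ x i (i ∸ x i) ⟩
    i ∸ (i ∸ x i)
      ≡⟨ m∸[m∸n]≡n xi≤i ⟩
    x i ∎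
    where open ≡-Reasoning

𝟙<ᵇsuc : ∀ a v → 𝟙 (a <ᵇ suc v) ≡ 𝟙 (a <ᵇ v) + 𝟙 (a ≡ᵇ v)
𝟙<ᵇsuc a v with <-cmp a v
... | tri< a<v _ _ rewrite <ᵇ-true (m<n⇒m<1+n a<v) | <ᵇ-true a<v | ≡ᵇ-false (<⇒≢ a<v) = refl
... | tri≈ _ refl _ rewrite <ᵇ-true (n<1+n a) | <ᵇ-false (≤-refl {a}) | ≡ᵇ-refl a = refl
... | tri> _ _ v<a rewrite <ᵇ-false v<a | <ᵇ-false (<⇒≤ v<a) | ≡ᵇ-false (≢-sym (<⇒≢ v<a)) = refl

module Reconstruction (n : ℕ) (s : ℕ → ℕ)
  (s-injective : ∀ {j k} → j < n → k < n → s j ≡ s k → j ≡ k) where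

  rank : ℕ → ℕ → ℕ
  rank m i = count< (λ j → s j <ᵇ s i) m

  rank-self : ∀ {m} → m < n → rank m m ≡ m ∸ inversions s m
  rank-self {m} m<n = begin
    rank m m                                 ≡⟨ m+n∸n≡m (rank m m) (inversions s m) ⟨
    rank m m + inversions s m ∸ inversions s m ≡⟨ cong (_∸ inversions s m) (count<-complement _ _ m oneOf) ⟩
    m ∸ inversions s m                       ∎
    where
    open ≡-Reasoning
    oneOf : ∀ {k} → k < m → 𝟙 (s k <ᵇ s m) + 𝟙 (s m <ᵇ s k) ≡ 1
    oneOf {k} k<m with <-cmp (s k) (s m)
    ... | tri< sk<sm _ _ rewrite <ᵇ-true sk<sm | <ᵇ-false (<⇒≤ sk<sm) = refl
    ... | tri≈ _ sk≡sm _ = ⊥-elim (<⇒≢ k<m (s-injective (<-trans k<m m<n) m<n sk≡sm))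
    ... | tri> _ _ sm<sk rewrite <ᵇ-true sm<sk | <ᵇ-false (<⇒≤ sm<sk) = refl

  punchIn-rank : ∀ {m i} → i < m → m < n → punchIn (rank m m) (rank m i) ≡ rank m i + 𝟙 (s m <ᵇ s i)
  punchIn-rank {m} {i} i<m m<n with <-cmp (s m) (s i)
  ... | tri< sm<si _ _ rewrite <ᵇ-true sm<si =
    trans (punchIn-≥ (count<-mono-≤ m λ _ sj<sm → <⇒<ᵇ (<-trans (<ᵇ⇒< _ _ sj<sm) sm<si)))
          (+-comm 1 (rank m i))
  ... | tri≈ _ sm≡si _ = ⊥-elim (<⇒≢ i<m (s-injective (<-trans i<m m<n) m<n (sym sm≡si)))
  ... | tri> _ _ si<sm rewrite <ᵇ-false (<⇒≤ si<sm) =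
    trans (punchIn-< (count<-mono-< m (λ _ sj<si → <⇒<ᵇ (<-trans (<ᵇ⇒< _ _ sj<si) si<sm))
                                    i<m (<ᵇ-false (≤-refl {s i})) (<ᵇ-true si<sm)))
          (sym (+-identityʳ (rank m i)))

  position≡rank : ∀ {m i} → m ≤ n → i < m → position (inversions s) m i ≡ rank m i
  position≡rank {suc m} {i} m<n i<1+m with m<1+n⇒m<n∨m≡n i<1+m
  ... | inj₂ refl = begin
    position (inversions s) (suc i) i ≡⟨ position-new (inversions s) i ⟩
    i ∸ inversions s i                ≡⟨ rank-self m<n ⟨
    rank i i                          ≡⟨ +-identityʳ (rank i i) ⟨
    rank i i + 0                      ≡⟨ cong (λ b → rank i i + 𝟙 b) (<ᵇ-false (≤-refl {s i})) ⟨
    rank i i + 𝟙 (s i <ᵇ s i)         ≡⟨ sum<-snoc _ i ⟨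
    rank (suc i) i                    ∎
    where open ≡-Reasoning
  ... | inj₁ i<m = begin
    position (inversions s) (suc m) i                  ≡⟨ position-old (inversions s) i<m ⟩
    punchIn (m ∸ inversions s m) (position (inversions s) m i)
      ≡⟨ cong₂ punchIn (sym (rank-self m<n)) (position≡rank (<⇒≤ m<n) i<m) ⟩
    punchIn (rank m m) (rank m i)                      ≡⟨ punchIn-rank i<m m<n ⟩
    rank m i + 𝟙 (s m <ᵇ s i)                          ≡⟨ sum<-snoc _ m ⟨
    rank (suc m) i                                     ∎
    where open ≡-Reasoning

  module _ (s-surjective : ∀ {v} → v < n → ∃ λ j → j < n × s j ≡ v) where

    count-≡ᵇ : ∀ {v} → v < n → count< (λ j → s j ≡ᵇ v) n ≡ 1
    count-≡ᵇ {v} v<n with s-surjective v<n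
    ... | j₀ , j₀<n , sj₀≡v = trans (sum<-cong n atJ₀) (count<-≡ᵇ n j₀<n)
      where
      atJ₀ : ∀ {k} → k < n → 𝟙 (s k ≡ᵇ v) ≡ 𝟙 (k ≡ᵇ j₀)
      atJ₀ {k} k<n with k ≟ j₀
      ... | yes refl rewrite sj₀≡v | ≡ᵇ-refl v | ≡ᵇ-refl k = refl
      ... | no  k≢j₀ rewrite ≡ᵇ-false k≢j₀
                           | ≡ᵇ-false (λ sk≡v → k≢j₀ (s-injective k<n j₀<n (trans sk≡v (sym sj₀≡v)))) = refl

    count-<ᵇ : ∀ {v} → v ≤ n → count< (λ j → s j <ᵇ v) n ≡ v
    count-<ᵇ {zero}  _   = sum<-zero n
    count-<ᵇ {suc v} v<n = begin
      count< (λ j → s j <ᵇ suc v) n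
        ≡⟨ sum<-cong n (λ {k} _ → 𝟙<ᵇsuc (s k) v) ⟩
      sum< (λ k → 𝟙 (s k <ᵇ v) + 𝟙 (s k ≡ᵇ v)) n
        ≡⟨ sum<-+ _ _ n ⟩
      count< (λ j → s j <ᵇ v) n + count< (λ j → s j ≡ᵇ v) n
        ≡⟨ cong₂ _+_ (count-<ᵇ (<⇒≤ v<n)) (count-≡ᵇ v<n) ⟩
      v + 1
        ≡⟨ +-comm v 1 ⟩
      suc v ∎
      where open ≡-Reasoning

    position-inversions : (∀ {j} → j < n → s j < n) → ∀ {i} → i < n → position (inversions s) n i ≡ s i
    position-inversions s-< i<n = trans (position≡rank ≤-refl i<n) (count-<ᵇ (<⇒≤ (s-< i<n)))

sumBy : ∀ {A : Set} → (A → ℕ) → List A → ℕ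
sumBy f []       = 0
sumBy f (x ∷ xs) = f x + sumBy f xs

module _ {A : Set} where

  sumBy-cong : ∀ {f g : A → ℕ} xs → (∀ x → f x ≡ g x) → sumBy f xs ≡ sumBy g xs
  sumBy-cong []       f≗g = refl
  sumBy-cong (x ∷ xs) f≗g = cong₂ _+_ (f≗g x) (sumBy-cong xs f≗g)

  sumBy-cong-All : ∀ {f g : A → ℕ} {xs} → All (λ x → f x ≡ g x) xs → sumBy f xs ≡ sumBy g xs
  sumBy-cong-All []           = refl
  sumBy-cong-All (fx≡gx ∷ eqs) = cong₂ _+_ fx≡gx (sumBy-cong-All eqs)

  sumBy-++ : ∀ (f : A → ℕ) xs ys → sumBy f (xs ++ ys) ≡ sumBy f xs + sumBy f ys
  sumBy-++ f []       ys = refl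
  sumBy-++ f (x ∷ xs) ys = trans (cong (f x +_) (sumBy-++ f xs ys)) (sym (+-assoc (f x) _ _))

  sumBy-0 : ∀ (xs : List A) → sumBy (λ _ → 0) xs ≡ 0
  sumBy-0 []       = refl
  sumBy-0 (x ∷ xs) = sumBy-0 xs

  sumBy-+ : ∀ (f g : A → ℕ) xs → sumBy (λ x → f x + g x) xs ≡ sumBy f xs + sumBy g xs
  sumBy-+ f g []       = refl
  sumBy-+ f g (x ∷ xs) =
    trans (cong (f x + g x +_) (sumBy-+ f g xs)) (interchange (f x) (g x) _ _)

  sumBy-*ˡ : ∀ (f : A → ℕ) c xs → sumBy (λ x → c * f x) xs ≡ c * sumBy f xs
  sumBy-*ˡ f c []       = sym (*-zeroʳ c)
  sumBy-*ˡ f c (x ∷ xs) = trans (cong (c * f x +_) (sumBy-*ˡ f c xs)) (sym (*-distribˡ-+ c (f x) _))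

  sumBy-*ʳ : ∀ (f : A → ℕ) c xs → sumBy (λ x → f x * c) xs ≡ sumBy f xs * c
  sumBy-*ʳ f c xs =
    trans (sumBy-cong xs (λ x → *-comm (f x) c)) (trans (sumBy-*ˡ f c xs) (*-comm c _))

  length-filter : ∀ (p : A → Bool) xs → length (filter (T? ∘ p) xs) ≡ sumBy (𝟙 ∘ p) xs
  length-filter p []       = refl
  length-filter p (x ∷ xs) with p x
  ... | true  = cong suc (length-filter p xs)
  ... | false = length-filter p xs

  sumBy-filter : ∀ (p : A → Bool) (f : A → ℕ) xs →
                 sumBy f (filter (T? ∘ p) xs) ≡ sumBy (λ x → 𝟙 (p x) * f x) xs
  sumBy-filter p f []       = refl
  sumBy-filter p f (x ∷ xs) with p x
  ... | true  = cong₂ _+_ (sym (+-identityʳ (f x))) (sumBy-filter p f xs)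
  ... | false = sumBy-filter p f xs

  sumBy-tabulate : ∀ {n} (f : A → ℕ) (h : Fin n → A) (g : ℕ → ℕ) →
                   (∀ j → g (toℕ j) ≡ f (h j)) → sumBy f (tabulate h) ≡ sum< g n
  sumBy-tabulate {zero}  f h g g≗fh = refl
  sumBy-tabulate {suc n} f h g g≗fh =
    cong₂ _+_ (sym (g≗fh Fin.zero)) (sumBy-tabulate f (h ∘ Fin.suc) (g ∘ suc) (g≗fh ∘ Fin.suc))

sumBy-map : ∀ {A B : Set} (f : B → ℕ) (g : A → B) xs → sumBy f (map g xs) ≡ sumBy (f ∘ g) xs
sumBy-map f g []       = refl
sumBy-map f g (x ∷ xs) = cong (f (g x) +_) (sumBy-map f g xs)

module _ {A B : Set} where

  sumBy-concatMap : ∀ (f : B → ℕ) (g : A → List B) xs →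
                    sumBy f (concatMap g xs) ≡ sumBy (sumBy f ∘ g) xs
  sumBy-concatMap f g []       = refl
  sumBy-concatMap f g (x ∷ xs) =
    trans (sumBy-++ f (g x) (concat (map g xs))) (cong (sumBy f (g x) +_) (sumBy-concatMap f g xs))

  sumBy-swap : ∀ (f : A → B → ℕ) xs ys →
               sumBy (λ x → sumBy (f x) ys) xs ≡ sumBy (λ y → sumBy (λ x → f x y) xs) ys
  sumBy-swap f []       ys = sym (sumBy-0 ys)
  sumBy-swap f (x ∷ xs) ys =
    trans (cong (sumBy (f x) ys +_) (sumBy-swap f xs ys))
          (sym (sumBy-+ (f x) (λ y → sumBy (λ x′ → f x′ y) xs) ys))

  sumBy-cartesianProduct : ∀ (f : A × B → ℕ) xs ys →
    sumBy f (cartesianProduct xs ys) ≡ sumBy (λ x → sumBy (λ y → f (x , y)) ys) xs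
  sumBy-cartesianProduct f []       ys = refl
  sumBy-cartesianProduct f (x ∷ xs) ys =
    trans (sumBy-++ f (map (x ,_) ys) (cartesianProduct xs ys))
          (cong₂ _+_ (sumBy-map f (x ,_) ys) (sumBy-cartesianProduct f xs ys))

sumBy-concatMap-map : ∀ {A B C : Set} (f : C → ℕ) (g : A → B → C) xs ys →
  sumBy f (concatMap (λ x → map (g x) ys) xs) ≡ sumBy (λ x → sumBy (f ∘ g x) ys) xs
sumBy-concatMap-map f g xs ys =
  trans (sumBy-concatMap f (λ x → map (g x) ys) xs) (sumBy-cong xs (λ x → sumBy-map f (g x) ys))

sumBy-product : ∀ {A B : Set} (f : A → ℕ) (g : B → ℕ) xs ys →
  sumBy (λ x → sumBy (λ y → f x * g y) ys) xs ≡ sumBy f xs * sumBy g ys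
sumBy-product f g xs ys =
  trans (sumBy-cong xs (λ x → sumBy-*ˡ g (f x) ys)) (sumBy-*ʳ f (sumBy g ys) xs)

sumBy-𝟙-∧ : ∀ {A B : Set} (p : A → Bool) (q : B → Bool) xs ys →
  sumBy (λ x → sumBy (λ y → 𝟙 (p x ∧ q y)) ys) xs ≡ sumBy (𝟙 ∘ p) xs * sumBy (𝟙 ∘ q) ys
sumBy-𝟙-∧ p q xs ys =
  trans (sumBy-cong xs (λ x → sumBy-cong ys (λ y → 𝟙-∧ (p x) (q y))))
        (sumBy-product (𝟙 ∘ p) (𝟙 ∘ q) xs ys)

multiplicity : ∀ {A : Set} → DecidableEquality A → A → List A → ℕ
multiplicity _≟_ a = sumBy (λ b → 𝟙 (does (a ≟ b)))

module _ {A B : Set} (_≟_ : DecidableEquality B) where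

  -- Double counting over the pairs (a, y) with φ a = y.
  sumBy-reindex : ∀ (φ : A → B) (wt : A → ℕ) (h : B → ℕ) {Q : B → Set} xs ys →
    All Q ys → (∀ a → Q (φ a)) → (∀ {y} → Q y → multiplicity _≟_ y ys ≡ 1) →
    (∀ {y} → Q y → sumBy (λ a → wt a * 𝟙 (does (φ a ≟ y))) xs ≡ 1) →
    sumBy (λ a → wt a * h (φ a)) xs ≡ sumBy h ys
  sumBy-reindex φ wt h {Q} xs ys ys-Q φ-Q ys-once fibre≡1 = sym (begin
    sumBy h ys
      ≡⟨ sumBy-cong-All (All.map (λ Qy → sym (trans (cong (_* h _) (fibre≡1 Qy)) (+-identityʳ _))) ys-Q) ⟩
    sumBy (λ y → sumBy (λ a → wt a * 𝟙 (does (φ a ≟ y))) xs * h y) ys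
      ≡⟨ sumBy-cong ys (λ y → sumBy-*ʳ _ (h y) xs) ⟨
    sumBy (λ y → sumBy (λ a → wt a * 𝟙 (does (φ a ≟ y)) * h y) xs) ys
      ≡⟨ sumBy-swap (λ a y → wt a * 𝟙 (does (φ a ≟ y)) * h y) xs ys ⟨
    sumBy (λ a → sumBy (λ y → wt a * 𝟙 (does (φ a ≟ y)) * h y) ys) xs
      ≡⟨ sumBy-cong xs (λ a → trans (sumBy-cong ys (λ y → *-assoc (wt a) _ (h y))) (sumBy-*ˡ _ (wt a) ys)) ⟩
    sumBy (λ a → wt a * sumBy (λ y → 𝟙 (does (φ a ≟ y)) * h y) ys) xs
      ≡⟨ sumBy-cong xs (λ a → cong (wt a *_) (pick (φ-Q a))) ⟩
    sumBy (λ a → wt a * h (φ a)) xs ∎)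
    where
    open ≡-Reasoning
    pick : ∀ {y} → Q y → sumBy (λ y′ → 𝟙 (does (y ≟ y′)) * h y′) ys ≡ h y
    pick {y} Qy = begin
      sumBy (λ y′ → 𝟙 (does (y ≟ y′)) * h y′) ys ≡⟨ sumBy-cong ys at ⟩
      sumBy (λ y′ → 𝟙 (does (y ≟ y′)) * h y) ys  ≡⟨ sumBy-*ʳ _ (h y) ys ⟩
      multiplicity _≟_ y ys * h y                ≡⟨ cong (_* h y) (ys-once Qy) ⟩
      1 * h y                                    ≡⟨ *-identityˡ (h y) ⟩
      h y                                        ∎
      where
      at : ∀ y′ → 𝟙 (does (y ≟ y′)) * h y′ ≡ 𝟙 (does (y ≟ y′)) * h y
      at y′ with y ≟ y′
      ... | yes refl = refl
      ... | no  _    = refl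

module _ {A B : Set} (_≟ᴬ_ : DecidableEquality A) (_≟ᴮ_ : DecidableEquality B) where

  fibre≡1 : ∀ (p : A → Bool) (φ : A → B) xs {a₀ y} → T (p a₀) → φ a₀ ≡ y →
    (∀ {a} → T (p a) → φ a ≡ y → a ≡ a₀) → multiplicity _≟ᴬ_ a₀ xs ≡ 1 →
    sumBy (λ a → 𝟙 (p a) * 𝟙 (does (φ a ≟ᴮ y))) xs ≡ 1
  fibre≡1 p φ xs {a₀} {y} pa₀ φa₀≡y unique a₀-once = trans (sumBy-cong xs at) a₀-once
    where
    at : ∀ a → 𝟙 (p a) * 𝟙 (does (φ a ≟ᴮ y)) ≡ 𝟙 (does (a₀ ≟ᴬ a))
    at a with p a in pa | φ a ≟ᴮ y | a₀ ≟ᴬ a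
    ... | false | _        | yes refl = ⊥-elim (subst T pa pa₀)
    ... | false | _        | no  _    = refl
    ... | true  | yes _    | yes _    = refl
    ... | true  | yes φa≡y | no a₀≢a  = ⊥-elim (a₀≢a (sym (unique (subst T (sym pa) tt) φa≡y)))
    ... | true  | no φa≢y  | yes refl = ⊥-elim (φa≢y φa₀≡y)
    ... | true  | no  _    | no  _    = refl

extend : ∀ {n} → (Fin n → ℕ) → ℕ → ℕ
extend {n} f k with k <? n
... | yes k<n = f (fromℕ< k<n)
... | no  _   = 0

extend-< : ∀ {n} (f : Fin n → ℕ) {k} (k<n : k < n) → extend f k ≡ f (fromℕ< k<n)
extend-< {n} f {k} k<n with k <? n
... | yes _   = refl
... | no  k≮n = ⊥-elim (k≮n k<n)

extend-toℕ : ∀ {n} (f : Fin n → ℕ) j → extend f (toℕ j) ≡ f j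
extend-toℕ f j = trans (extend-< f (toℕ<n j)) (cong f (fromℕ<-toℕ j (toℕ<n j)))

sum<-restrict : ∀ P {m} n → m ≤ n → sum< (λ k → 𝟙 ((k <ᵇ m) ∧ P k)) n ≡ count< P m
sum<-restrict P {zero}  zero    _         = refl
sum<-restrict P {zero}  (suc n) _         = sum<-zero n
sum<-restrict P {suc m} (suc n) (s≤s m≤n) = cong (𝟙 (P 0) +_) (sum<-restrict (P ∘ suc) n m≤n)

invℕ : ∀ {n} → Word n → ℕ → ℕ
invℕ w = extend (toℕ ∘ inv w)

invSeq≡inversions : ∀ {n} (w : Word n) i → invSeq w i ≡ inversions (invℕ w) (toℕ i)
invSeq≡inversions {n} w i = begin
  invSeq w i
    ≡⟨ length-filter (λ j → ⌊ j <?ᶠ i ⌋ ∧ ⌊ inv w i <?ᶠ inv w j ⌋) (allFin n) ⟩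
  sumBy (λ j → 𝟙 (⌊ j <?ᶠ i ⌋ ∧ ⌊ inv w i <?ᶠ inv w j ⌋)) (allFin n)
    ≡⟨ sumBy-tabulate _ (λ j → j) (λ k → 𝟙 ((k <ᵇ toℕ i) ∧ (invℕ w (toℕ i) <ᵇ invℕ w k)))
         (λ j → cong₂ (λ a b → 𝟙 (a ∧ b))
                  (sym (isYes≗does (j <?ᶠ i)))
                  (trans (cong₂ _<ᵇ_ (extend-toℕ _ i) (extend-toℕ _ j))
                         (sym (isYes≗does (inv w i <?ᶠ inv w j))))) ⟩
  sum< (λ k → 𝟙 ((k <ᵇ toℕ i) ∧ (invℕ w (toℕ i) <ᵇ invℕ w k))) n
    ≡⟨ sum<-restrict _ n (<⇒≤ (toℕ<n i)) ⟩
  inversions (invℕ w) (toℕ i) ∎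
  where open ≡-Reasoning

invSeq-≤ : ∀ {n} (w : Word n) i → invSeq w i ≤ toℕ i
invSeq-≤ w i = subst (_≤ toℕ i) (sym (invSeq≡inversions w i)) (count<-≤ _ (toℕ i))

injective⇒surjective : ∀ {n} (f : Fin n → Fin n) → (∀ {a b} → f a ≡ f b → a ≡ b) →
                       ∀ y → ∃ λ x → f x ≡ y
injective⇒surjective {suc n} f f-inj y with any? (λ x → f x ≟ᶠ y)
... | yes hit  = hit
... | no  miss = ⊥-elim (1+n≰n (injective⇒≤ g-inj))
  where
  g : Fin (suc n) → Fin n
  g x = punchOut {i = y} {j = f x} (λ y≡fx → miss (x , sym y≡fx))
  g-inj : ∀ {a b} → g a ≡ g b → a ≡ b
  g-inj {a} {b} = f-inj ∘ punchOut-injective (λ y≡fa → miss (a , sym y≡fa)) (λ y≡fb → miss (b , sym y≡fb))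

firstOr-unique : ∀ {A : Set} {d a : A} {t : A → Bool} {xs} →
                 (∀ {y} → T (t y) → y ≡ a) → T (t a) → a ∈ xs → firstOr d t xs ≡ a
firstOr-unique {t = t} {x ∷ xs} unique ta a∈ with t x in tx
... | true  = unique (subst T (sym tx) tt)
... | false with a∈
...   | here refl   = ⊥-elim (subst T tx ta)
...   | there a∈xs  = firstOr-unique unique ta a∈xs

inv-unique : ∀ {n} {w : Word n} {i a} →
             (∀ {p} → lookup w p ≡ i → p ≡ a) → lookup w a ≡ i → inv w i ≡ a
inv-unique {n} unique wa≡i =
  firstOr-unique (unique ∘ toWitness) (fromWitness wa≡i) (∈-allFin _)

distinctAt : ∀ {n} → Word n → Fin n → Fin n → Bool
distinctAt w p q = ⌊ p ≟ᶠ q ⌋ ∨ not ⌊ lookup w p ≟ᶠ lookup w q ⌋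

distinctAt⁻ : ∀ {n} (w : Word n) {p q} → T (distinctAt w p q) → lookup w p ≡ lookup w q → p ≡ q
distinctAt⁻ w {p} {q} test wp≡wq with p ≟ᶠ q | lookup w p ≟ᶠ lookup w q
... | yes p≡q | _         = p≡q
... | no  _   | yes _     = ⊥-elim test
... | no  _   | no wp≢wq  = ⊥-elim (wp≢wq wp≡wq)

distinctAt⁺ : ∀ {n} (w : Word n) {p q} → (lookup w p ≡ lookup w q → p ≡ q) → T (distinctAt w p q)
distinctAt⁺ w {p} {q} same with p ≟ᶠ q | lookup w p ≟ᶠ lookup w q
... | yes _   | _        = tt
... | no  p≢q | yes wp≡wq = p≢q (same wp≡wq)
... | no  _   | no  _    = tt

isPerm⁻ : ∀ {n} (w : Word n) → T (isPerm w) → ∀ {p q} → lookup w p ≡ lookup w q → p ≡ q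
isPerm⁻ {n} w perm {p} {q} = distinctAt⁻ w
  (All.lookup (all⁺ (distinctAt w p) (allFin n)
    (All.lookup (all⁺ (λ p → all (distinctAt w p) (allFin n)) (allFin n) perm) (∈-allFin p))) (∈-allFin q))

isPerm⁺ : ∀ {n} (w : Word n) → (∀ {p q} → lookup w p ≡ lookup w q → p ≡ q) → T (isPerm w)
isPerm⁺ {n} w w-inj = all⁻ (λ p → all (distinctAt w p) (allFin n)) {allFin n}
  (All.tabulate λ {p} _ → all⁻ (distinctAt w p) {allFin n} (All.tabulate λ _ → distinctAt⁺ w w-inj))

module Permutation {n} (w : Word n) (w-perm : T (isPerm w)) where

  lookup-injective : ∀ {p q} → lookup w p ≡ lookup w q → p ≡ q
  lookup-injective = isPerm⁻ w w-perm

  lookup-inv : ∀ i → lookup w (inv w i) ≡ i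
  lookup-inv i with injective⇒surjective (lookup w) lookup-injective i
  ... | p , wp≡i = trans (cong (lookup w) inv≡p) wp≡i
    where
    inv≡p : inv w i ≡ p
    inv≡p = inv-unique {w = w} (λ wq≡i → lookup-injective (trans wq≡i (sym wp≡i))) wp≡i

  inv-lookup : ∀ p → inv w (lookup w p) ≡ p
  inv-lookup p = lookup-injective (lookup-inv (lookup w p))

  invℕ-< : ∀ {j} → j < n → invℕ w j < n
  invℕ-< j<n = subst (_< n) (sym (extend-< _ j<n)) (toℕ<n _)

  invℕ-injective : ∀ {j k} → j < n → k < n → invℕ w j ≡ invℕ w k → j ≡ k
  invℕ-injective {j} {k} j<n k<n eq = begin
    j                               ≡⟨ toℕ-fromℕ< j<n ⟨
    toℕ (fromℕ< j<n)                ≡⟨ cong toℕ (lookup-inv (fromℕ< j<n)) ⟨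
    toℕ (lookup w (inv w (fromℕ< j<n))) ≡⟨ cong (toℕ ∘ lookup w) inv≡inv ⟩
    toℕ (lookup w (inv w (fromℕ< k<n))) ≡⟨ cong toℕ (lookup-inv (fromℕ< k<n)) ⟩
    toℕ (fromℕ< k<n)                ≡⟨ toℕ-fromℕ< k<n ⟩
    k                               ∎
    where
    open ≡-Reasoning
    inv≡inv : inv w (fromℕ< j<n) ≡ inv w (fromℕ< k<n)
    inv≡inv = toℕ-injective (trans (sym (extend-< _ j<n)) (trans eq (extend-< _ k<n)))

  invℕ-surjective : ∀ {v} → v < n → ∃ λ j → j < n × invℕ w j ≡ v
  invℕ-surjective {v} v<n = toℕ (lookup w (fromℕ< v<n)) , toℕ<n _ ,
    trans (extend-toℕ (toℕ ∘ inv w) _) (trans (cong toℕ (inv-lookup (fromℕ< v<n))) (toℕ-fromℕ< v<n))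

  open Reconstruction n (invℕ w) invℕ-injective

  invℕ≡position : ∀ {k} → k < n → invℕ w k ≡ position (inversions (invℕ w)) n k
  invℕ≡position = sym ∘ position-inversions invℕ-surjective invℕ-<

invSeq-injective : ∀ {n} {w w′ : Word n} → T (isPerm w) → T (isPerm w′) →
                   (∀ i → invSeq w i ≡ invSeq w′ i) → w ≡ w′
invSeq-injective {n} {w} {w′} w-perm w′-perm I≗I′ = begin
  w                       ≡⟨ tabulate∘lookup w ⟨
  Vec.tabulate (lookup w)  ≡⟨ tabulate-cong lookup≗lookup′ ⟩
  Vec.tabulate (lookup w′) ≡⟨ tabulate∘lookup w′ ⟩
  w′                      ∎
  where
  open ≡-Reasoning
  module P  = Permutation w  w-perm
  module P′ = Permutation w′ w′-perm
  inversions≡ : ∀ {k} → k < n → inversions (invℕ w) k ≡ inversions (invℕ w′) k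
  inversions≡ {k} k<n = subst (λ k → inversions (invℕ w) k ≡ inversions (invℕ w′) k) (toℕ-fromℕ< k<n) (begin
    inversions (invℕ w) (toℕ i)   ≡⟨ invSeq≡inversions w i ⟨
    invSeq w i                    ≡⟨ I≗I′ i ⟩
    invSeq w′ i                   ≡⟨ invSeq≡inversions w′ i ⟩
    inversions (invℕ w′) (toℕ i)  ∎)
    where i = fromℕ< k<n
  invℕ≡ : ∀ {k} → k < n → invℕ w k ≡ invℕ w′ k
  invℕ≡ k<n = trans (P.invℕ≡position k<n)
             (trans (position-cong n inversions≡ _) (sym (P′.invℕ≡position k<n)))
  inv≡ : ∀ i → inv w i ≡ inv w′ i
  inv≡ i = toℕ-injective (trans (sym (extend-toℕ _ i)) (trans (invℕ≡ (toℕ<n i)) (extend-toℕ _ i)))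
  lookup≗lookup′ : ∀ p → lookup w p ≡ lookup w′ p
  lookup≗lookup′ p = begin
    lookup w p                        ≡⟨ P′.lookup-inv (lookup w p) ⟨
    lookup w′ (inv w′ (lookup w p))   ≡⟨ cong (lookup w′) (inv≡ (lookup w p)) ⟨
    lookup w′ (inv w (lookup w p))    ≡⟨ cong (lookup w′) (P.inv-lookup p) ⟩
    lookup w′ p                       ∎

-- The permutation with inversion sequence x: its inverse is the insertion construction for x.
module FromInversionSequence {n} (x : Vec ℕ n) (x-≤ : ∀ i → lookup x i ≤ toℕ i) where

  pos : ℕ → ℕ
  pos = position (extend (lookup x)) n

  word : Word n
  word = Vec.tabulate λ p → fromℕ< (proj₁ (proj₂ (position-surjective (extend (lookup x)) (toℕ<n p))))

  pos-word : ∀ p → pos (toℕ (lookup word p)) ≡ toℕ p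
  pos-word p = trans (cong (pos ∘ toℕ) (lookup∘tabulate _ p))
                     (trans (cong pos (toℕ-fromℕ< _)) (proj₂ (proj₂ (position-surjective _ (toℕ<n p)))))

  word-injective : ∀ {p q} → lookup word p ≡ lookup word q → p ≡ q
  word-injective {p} {q} eq =
    toℕ-injective (trans (sym (pos-word p)) (trans (cong (pos ∘ toℕ) eq) (pos-word q)))

  inv-word : ∀ i → toℕ (inv word i) ≡ pos (toℕ i)
  inv-word i = trans (cong toℕ (inv-unique {w = word} unique word-a≡i)) (toℕ-fromℕ< _)
    where
    a : Fin n
    a = fromℕ< (position-< (extend (lookup x)) (toℕ<n i))
    word-a≡i : lookup word a ≡ i
    word-a≡i = toℕ-injective (position-injective _ (toℕ<n (lookup word a)) (toℕ<n i)
                                (trans (pos-word a) (toℕ-fromℕ< _)))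
    unique : ∀ {p} → lookup word p ≡ i → p ≡ a
    unique {p} wp≡i =
      toℕ-injective (trans (sym (pos-word p)) (trans (cong (pos ∘ toℕ) wp≡i) (sym (toℕ-fromℕ< _))))

  invℕ-word : ∀ {k} → k < n → invℕ word k ≡ pos k
  invℕ-word k<n = trans (extend-< _ k<n) (trans (inv-word (fromℕ< k<n)) (cong pos (toℕ-fromℕ< k<n)))

  invSeq-word : ∀ i → invSeq word i ≡ lookup x i
  invSeq-word i = begin
    invSeq word i                       ≡⟨ invSeq≡inversions word i ⟩
    inversions (invℕ word) (toℕ i)      ≡⟨ sum<-cong (toℕ i) (λ k<i → cong 𝟙 (cong₂ _<ᵇ_
                                              (invℕ-word (toℕ<n i)) (invℕ-word (<-trans k<i (toℕ<n i))))) ⟩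
    inversions pos (toℕ i)              ≡⟨ inversions-position _ (toℕ<n i) x-≤′ ⟩
    extend (lookup x) (toℕ i)           ≡⟨ extend-toℕ _ i ⟩
    lookup x i                          ∎
    where
    open ≡-Reasoning
    x-≤′ : extend (lookup x) (toℕ i) ≤ toℕ i
    x-≤′ = subst (_≤ toℕ i) (sym (extend-toℕ _ i)) (x-≤ i)

invSeq-surjective : ∀ {n} (x : Vec ℕ n) → (∀ i → lookup x i ≤ toℕ i) →
                    ∃ λ w → T (isPerm w) × (∀ i → invSeq w i ≡ lookup x i)
invSeq-surjective x x-≤ = word , isPerm⁺ word word-injective , invSeq-word
  where open FromInversionSequence x x-≤

multiplicity-allFin : ∀ {n} (a : Fin n) → multiplicity _≟ᶠ_ a (allFin n) ≡ 1
multiplicity-allFin {n} a =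
  trans (sumBy-tabulate _ (λ j → j) (λ k → 𝟙 (k ≡ᵇ toℕ a)) at) (count<-≡ᵇ n (toℕ<n a))
  where
  at : ∀ j → 𝟙 (toℕ j ≡ᵇ toℕ a) ≡ 𝟙 (does (a ≟ᶠ j))
  at j with a ≟ᶠ j
  ... | yes refl = cong 𝟙 (≡ᵇ-refl (toℕ a))
  ... | no  a≢j  = cong 𝟙 (≡ᵇ-false (λ j≡a → a≢j (sym (toℕ-injective j≡a))))

multiplicity-allWords : ∀ n k (v : Vec (Fin n) k) → multiplicity (≡-dec _≟ᶠ_) v (allWords n k) ≡ 1
multiplicity-allWords n zero    []       = refl
multiplicity-allWords n (suc k) (a ∷ vs) = begin
  multiplicity (≡-dec _≟ᶠ_) (a ∷ vs) (allWords n (suc k))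
    ≡⟨ sumBy-concatMap-map _ (λ ws b → b ∷ ws) (allWords n k) (allFin n) ⟩
  sumBy (λ ws → sumBy (λ b → 𝟙 (does (a ≟ᶠ b) ∧ does (≡-dec _≟ᶠ_ vs ws))) (allFin n)) (allWords n k)
    ≡⟨ sumBy-swap _ (allWords n k) (allFin n) ⟩
  sumBy (λ b → sumBy (λ ws → 𝟙 (does (a ≟ᶠ b) ∧ does (≡-dec _≟ᶠ_ vs ws))) (allWords n k)) (allFin n)
    ≡⟨ sumBy-𝟙-∧ (λ b → does (a ≟ᶠ b)) (λ ws → does (≡-dec _≟ᶠ_ vs ws)) (allFin n) (allWords n k) ⟩
  multiplicity _≟ᶠ_ a (allFin n) * multiplicity (≡-dec _≟ᶠ_) vs (allWords n k)
    ≡⟨ cong₂ _*_ (multiplicity-allFin a) (multiplicity-allWords n k vs) ⟩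
  1 ∎
  where open ≡-Reasoning

Bounded : ∀ {n} → ℕ → Vec ℕ n → Set
Bounded b y = ∀ i → lookup y i ≤ b + toℕ i

-- All y with y_i ≤ b + i; for b = 0 these are the inversion sequences.
boundedSeqs : ℕ → (n : ℕ) → List (Vec ℕ n)
boundedSeqs b zero    = [] ∷ []
boundedSeqs b (suc n) = concatMap (λ a → map (a ∷_) (boundedSeqs (suc b) n)) (downFrom (suc b))

Bounded-∷ : ∀ {n b c} {y : Vec ℕ n} → c ≤ b → Bounded (suc b) y → Bounded b (c ∷ y)
Bounded-∷ {b = b} {c} c≤b y-bnd Fin.zero    = subst (c ≤_) (sym (+-identityʳ b)) c≤b
Bounded-∷ {b = b} {y = y} c≤b y-bnd (Fin.suc i) = subst (lookup y i ≤_) (sym (+-suc b (toℕ i))) (y-bnd i)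

Bounded-head : ∀ {n b c} {y : Vec ℕ n} → Bounded b (c ∷ y) → c < suc b
Bounded-head {b = b} {c} bnd = s≤s (subst (c ≤_) (+-identityʳ b) (bnd Fin.zero))

Bounded-tail : ∀ {n b c} {y : Vec ℕ n} → Bounded b (c ∷ y) → Bounded (suc b) y
Bounded-tail {b = b} {y = y} bnd i = subst (lookup y i ≤_) (+-suc b (toℕ i)) (bnd (Fin.suc i))

boundedSeqs-Bounded : ∀ b n → All (Bounded b) (boundedSeqs b n)
boundedSeqs-Bounded b zero    = (λ ()) ∷ []
boundedSeqs-Bounded b (suc n) = concat⁺ (map⁺ (applyDownFrom⁺₁ _ (suc b) λ c<1+b →
  map⁺ (All.map (Bounded-∷ (<⇒≤pred c<1+b)) (boundedSeqs-Bounded (suc b) n))))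

multiplicity-downFrom : ∀ {a} m → a < m → multiplicity _≟_ a (downFrom m) ≡ 1
multiplicity-downFrom {a} (suc m) a<1+m with m<1+n⇒m<n∨m≡n a<1+m
... | inj₂ refl rewrite dec-true (a ≟ a) refl = cong suc (absent a ≤-refl)
  where
  absent : ∀ m → m ≤ a → multiplicity _≟_ a (downFrom m) ≡ 0
  absent zero    _       = refl
  absent (suc m) 1+m≤a rewrite dec-false (a ≟ m) (≢-sym (<⇒≢ 1+m≤a)) = absent m (<⇒≤ 1+m≤a)
... | inj₁ a<m rewrite dec-false (a ≟ m) (<⇒≢ a<m) = multiplicity-downFrom m a<m

multiplicity-boundedSeqs : ∀ b n {x : Vec ℕ n} → Bounded b x →
                           multiplicity (≡-dec _≟_) x (boundedSeqs b n) ≡ 1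
multiplicity-boundedSeqs b zero    {[]}     _     = refl
multiplicity-boundedSeqs b (suc n) {a ∷ xs} x-bnd = begin
  multiplicity (≡-dec _≟_) (a ∷ xs) (boundedSeqs b (suc n))
    ≡⟨ sumBy-concatMap-map _ (λ c ys → c ∷ ys) D L ⟩
  sumBy (λ c → sumBy (λ ys → 𝟙 (does (a ≟ c) ∧ does (≡-dec _≟_ xs ys))) L) D
    ≡⟨ sumBy-𝟙-∧ (λ c → does (a ≟ c)) (λ ys → does (≡-dec _≟_ xs ys)) D L ⟩
  multiplicity _≟_ a D * multiplicity (≡-dec _≟_) xs L
    ≡⟨ cong₂ _*_ (multiplicity-downFrom (suc b) (Bounded-head x-bnd))
                 (multiplicity-boundedSeqs (suc b) n {xs} (Bounded-tail {c = a} x-bnd)) ⟩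
  1 ∎
  where
  open ≡-Reasoning
  D = downFrom (suc b)
  L = boundedSeqs (suc b) n

-- Counting comparable pairs

infix 4 _≤*_
_≤*_ : ∀ {n} → Vec ℕ n → Vec ℕ n → Bool
[]      ≤* []      = true
(a ∷ x) ≤* (c ∷ y) = (a ≤ᵇ c) ∧ (x ≤* y)

comparablePairs : ℕ → ℕ → ℕ
comparablePairs b n = sumBy (λ x → sumBy (λ y → 𝟙 (x ≤* y)) (boundedSeqs b n)) (boundedSeqs b n)

orderedPairs : ℕ → ℕ
orderedPairs b = sumBy (λ a → sumBy (λ c → 𝟙 (a ≤ᵇ c)) (downFrom (suc b))) (downFrom (suc b))

comparablePairs-suc : ∀ b n → comparablePairs b (suc n) ≡ orderedPairs b * comparablePairs (suc b) n
comparablePairs-suc b n = begin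
  comparablePairs b (suc n)
    ≡⟨ sumBy-concatMap-map _ (λ a xs → a ∷ xs) D L ⟩
  sumBy (λ a → sumBy (λ xs → sumBy (λ y → 𝟙 ((a ∷ xs) ≤* y)) (boundedSeqs b (suc n))) L) D
    ≡⟨ sumBy-cong D (λ a → sumBy-cong L (λ xs → above a xs)) ⟩
  sumBy (λ a → sumBy (λ xs → sumBy (λ c → 𝟙 (a ≤ᵇ c)) D * sumBy (λ ys → 𝟙 (xs ≤* ys)) L) L) D
    ≡⟨ sumBy-product (λ a → sumBy (λ c → 𝟙 (a ≤ᵇ c)) D) (λ xs → sumBy (λ ys → 𝟙 (xs ≤* ys)) L) D L ⟩
  orderedPairs b * comparablePairs (suc b) n ∎
  where
  open ≡-Reasoning
  D = downFrom (suc b)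
  L = boundedSeqs (suc b) n
  above : ∀ a xs → sumBy (λ y → 𝟙 ((a ∷ xs) ≤* y)) (boundedSeqs b (suc n)) ≡
                   sumBy (λ c → 𝟙 (a ≤ᵇ c)) D * sumBy (λ ys → 𝟙 (xs ≤* ys)) L
  above a xs = trans (sumBy-concatMap-map _ (λ c ys → c ∷ ys) D L)
                     (sumBy-𝟙-∧ (a ≤ᵇ_) (xs ≤*_) D L)

triangle : ℕ → ℕ
triangle i = (i + 2) C 2

triangle-suc : ∀ c → triangle (suc c) ≡ suc (suc c) + triangle c
triangle-suc c = begin
  triangle (suc c)             ≡⟨ nCk+nC[k+1]≡[n+1]C[k+1] (c + 2) 1 ⟨
  (c + 2) C 1 + triangle c     ≡⟨ cong (_+ triangle c) (trans (nC1≡n (c + 2)) (+-comm c 2)) ⟩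
  suc (suc c) + triangle c     ∎
  where open ≡-Reasoning

count-downFrom-≥ : ∀ k m → m ≤ k → sumBy (λ c → 𝟙 (k ≤ᵇ c)) (downFrom m) ≡ 0
count-downFrom-≥ k zero    _     = refl
count-downFrom-≥ k (suc m) 1+m≤k rewrite ≤ᵇ-false 1+m≤k = count-downFrom-≥ k m (<⇒≤ 1+m≤k)

count-downFrom-≤ : ∀ k m → m ≤ suc k → sumBy (λ a → 𝟙 (a ≤ᵇ k)) (downFrom m) ≡ m
count-downFrom-≤ k zero    _       = refl
count-downFrom-≤ k (suc m) 1+m≤1+k rewrite ≤ᵇ-true (<⇒≤pred 1+m≤1+k) =
  cong suc (count-downFrom-≤ k m (<⇒≤ 1+m≤1+k))

orderedPairs≡triangle : ∀ b → orderedPairs b ≡ triangle b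
orderedPairs≡triangle zero    = refl
orderedPairs≡triangle (suc c) = begin
  orderedPairs (suc c)
    ≡⟨⟩
  (𝟙 (suc c ≤ᵇ suc c) + sumBy (λ c′ → 𝟙 (suc c ≤ᵇ c′)) D)
    + sumBy (λ a → 𝟙 (a ≤ᵇ suc c) + sumBy (λ c′ → 𝟙 (a ≤ᵇ c′)) D) D
    ≡⟨ cong₂ _+_ (cong₂ _+_ (cong 𝟙 (≤ᵇ-true (≤-refl {suc c})))
                            (count-downFrom-≥ (suc c) (suc c) ≤-refl))
                 (sumBy-+ (λ a → 𝟙 (a ≤ᵇ suc c)) (λ a → sumBy (λ c′ → 𝟙 (a ≤ᵇ c′)) D) D) ⟩
  1 + (sumBy (λ a → 𝟙 (a ≤ᵇ suc c)) D + orderedPairs c)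
    ≡⟨ cong (λ k → 1 + (k + orderedPairs c)) (count-downFrom-≤ (suc c) (suc c) (n≤1+n _)) ⟩
  1 + (suc c + orderedPairs c)
    ≡⟨ cong (λ k → 1 + (suc c + k)) (orderedPairs≡triangle c) ⟩
  suc (suc c) + triangle c
    ≡⟨ triangle-suc c ⟨
  triangle (suc c) ∎
  where
  open ≡-Reasoning
  D = downFrom (suc c)

triangleProduct : ℕ → ℕ → ℕ
triangleProduct b zero    = 1
triangleProduct b (suc n) = triangle b * triangleProduct (suc b) n

comparablePairs≡triangleProduct : ∀ b n → comparablePairs b n ≡ triangleProduct b n
comparablePairs≡triangleProduct b zero    = refl
comparablePairs≡triangleProduct b (suc n) =
  trans (comparablePairs-suc b n)
        (cong₂ _*_ (orderedPairs≡triangle b) (comparablePairs≡triangleProduct (suc b) n))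

binomProduct≡triangleProduct : ∀ n → binomProduct n ≡ triangleProduct 0 n
binomProduct≡triangleProduct n = shifted n 0 (λ i → i) (λ i → refl)
  where
  shifted : ∀ n b (f : ℕ → ℕ) → (∀ i → f i ≡ b + i) →
            product (map triangle (applyUpTo f n)) ≡ triangleProduct b n
  shifted zero    b f f≗b+ = refl
  shifted (suc n) b f f≗b+ =
    cong₂ _*_ (cong triangle (trans (f≗b+ 0) (+-identityʳ b)))
              (shifted n (suc b) (f ∘ suc) (λ i → trans (f≗b+ (suc i)) (+-suc b i)))

triangleProduct-snoc : ∀ b n → triangleProduct b (suc n) ≡ triangleProduct b n * triangle (b + n)
triangleProduct-snoc b zero    =
  trans (*-identityʳ (triangle b)) (trans (cong triangle (sym (+-identityʳ b))) (sym (+-identityʳ _)))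
triangleProduct-snoc b (suc n) = begin
  triangle b * triangleProduct (suc b) (suc n)
    ≡⟨ cong (triangle b *_) (triangleProduct-snoc (suc b) n) ⟩
  triangle b * (triangleProduct (suc b) n * triangle (suc b + n))
    ≡⟨ *-assoc (triangle b) _ _ ⟨
  triangle b * triangleProduct (suc b) n * triangle (suc b + n)
    ≡⟨ cong (λ k → triangle b * triangleProduct (suc b) n * triangle k) (+-suc b n) ⟨
  triangle b * triangleProduct (suc b) n * triangle (b + suc n) ∎
  where open ≡-Reasoning

2*triangle : ∀ c → 2 * triangle c ≡ (2 + c) * (1 + c)
2*triangle zero    = refl
2*triangle (suc c) = begin
  2 * triangle (suc c)                  ≡⟨ cong (2 *_) (triangle-suc c) ⟩
  2 * (2 + c + triangle c)              ≡⟨ *-distribˡ-+ 2 (2 + c) (triangle c) ⟩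
  2 * (2 + c) + 2 * triangle c          ≡⟨ cong (2 * (2 + c) +_) (2*triangle c) ⟩
  2 * (2 + c) + (2 + c) * (1 + c)       ≡⟨ factor-2+c c ⟩
  (3 + c) * (2 + c)                     ∎
  where
  open ≡-Reasoning
  factor-2+c : ∀ c → 2 * (2 + c) + (2 + c) * (1 + c) ≡ (3 + c) * (2 + c)
  factor-2+c = solve-∀

2^n*triangleProduct : ∀ n → 2 ^ n * triangleProduct 0 n ≡ n ! * suc n !
2^n*triangleProduct zero    = refl
2^n*triangleProduct (suc n) = begin
  2 ^ suc n * triangleProduct 0 (suc n)        ≡⟨ cong (2 ^ suc n *_) (triangleProduct-snoc 0 n) ⟩
  (2 * 2 ^ n) * (triangleProduct 0 n * triangle n) ≡⟨ regroup (2 ^ n) (triangleProduct 0 n) (triangle n) ⟩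
  (2 ^ n * triangleProduct 0 n) * (2 * triangle n) ≡⟨ cong₂ _*_ (2^n*triangleProduct n) (2*triangle n) ⟩
  (n ! * suc n !) * ((2 + n) * (1 + n))        ≡⟨ factorial-suc n (n !) ⟩
  suc n ! * suc (suc n) !                      ∎
  where
  open ≡-Reasoning
  regroup : ∀ a b c → (2 * a) * (b * c) ≡ (a * b) * (2 * c)
  regroup = solve-∀
  factorial-suc : ∀ n f → (f * ((1 + n) * f)) * ((2 + n) * (1 + n)) ≡ ((1 + n) * f) * ((2 + n) * ((1 + n) * f))
  factorial-suc = solve-∀

-- The middle order through inversion sequences

invSeqVec : ∀ {n} → Word n → Vec ℕ n
invSeqVec w = Vec.tabulate (invSeq w)

invSeqVec-Bounded : ∀ {n} (w : Word n) → Bounded 0 (invSeqVec w)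
invSeqVec-Bounded w i = subst (_≤ toℕ i) (sym (lookup∘tabulate (invSeq w) i)) (invSeq-≤ w i)

invSeqVec-injective : ∀ {n} {w w′ : Word n} → T (isPerm w) → T (isPerm w′) →
                      invSeqVec w ≡ invSeqVec w′ → w ≡ w′
invSeqVec-injective {w = w} {w′} w-perm w′-perm eq = invSeq-injective w-perm w′-perm λ i →
  trans (sym (lookup∘tabulate (invSeq w) i)) (trans (cong (λ v → lookup v i) eq) (lookup∘tabulate (invSeq w′) i))

all-≤ᵇ-tabulate : ∀ {m n} (f g : Fin m → ℕ) (h : Fin n → Fin m) →
  all (λ i → f i ≤ᵇ g i) (tabulate h) ≡ (Vec.tabulate (f ∘ h) ≤* Vec.tabulate (g ∘ h))
all-≤ᵇ-tabulate {n = zero}  f g h = refl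
all-≤ᵇ-tabulate {n = suc n} f g h = cong (_ ∧_) (all-≤ᵇ-tabulate f g (h ∘ Fin.suc))

middle≤ᵇ≡≤* : ∀ {n} (v w : Word n) → middle≤ᵇ v w ≡ (invSeqVec v ≤* invSeqVec w)
middle≤ᵇ≡≤* v w = all-≤ᵇ-tabulate (invSeq v) (invSeq w) (λ i → i)

sumBy-Sym-invSeqVec : ∀ n (h : Vec ℕ n → ℕ) → sumBy (h ∘ invSeqVec) (Sym n) ≡ sumBy h (boundedSeqs 0 n)
sumBy-Sym-invSeqVec n h =
  trans (sumBy-filter isPerm (h ∘ invSeqVec) (allWords n n))
        (sumBy-reindex (≡-dec _≟_) invSeqVec (𝟙 ∘ isPerm) h (allWords n n) (boundedSeqs 0 n)
           (boundedSeqs-Bounded 0 n) invSeqVec-Bounded (λ {y} → multiplicity-boundedSeqs 0 n {y}) fibre)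
  where
  fibre : ∀ {x} → Bounded 0 x →
          sumBy (λ w → 𝟙 (isPerm w) * 𝟙 (does (≡-dec _≟_ (invSeqVec w) x))) (allWords n n) ≡ 1
  fibre {x} x-bnd with invSeq-surjective x x-bnd
  ... | w₀ , w₀-perm , invSeq-w₀ =
    fibre≡1 (≡-dec _≟ᶠ_) (≡-dec _≟_) isPerm invSeqVec (allWords n n) {w₀} w₀-perm I-w₀
      (λ w-perm I-w → invSeqVec-injective w-perm w₀-perm (trans I-w (sym I-w₀)))
      (multiplicity-allWords n n w₀)
    where
    I-w₀ : invSeqVec w₀ ≡ x
    I-w₀ = trans (tabulate-cong invSeq-w₀) (tabulate∘lookup x)

numIntervals≡comparablePairs : ∀ n → numIntervals n ≡ comparablePairs 0 n
numIntervals≡comparablePairs n = begin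
  numIntervals n
    ≡⟨ length-filter _ (cartesianProduct (Sym n) (Sym n)) ⟩
  sumBy (λ vw → 𝟙 (middle≤ᵇ (proj₁ vw) (proj₂ vw))) (cartesianProduct (Sym n) (Sym n))
    ≡⟨ sumBy-cartesianProduct _ (Sym n) (Sym n) ⟩
  sumBy (λ v → sumBy (λ w → 𝟙 (middle≤ᵇ v w)) (Sym n)) (Sym n)
    ≡⟨ sumBy-cong (Sym n) (λ v → sumBy-cong (Sym n) (λ w → cong 𝟙 (middle≤ᵇ≡≤* v w))) ⟩
  sumBy (λ v → sumBy (λ w → 𝟙 (invSeqVec v ≤* invSeqVec w)) (Sym n)) (Sym n)
    ≡⟨ sumBy-cong (Sym n) (λ v → sumBy-Sym-invSeqVec n (λ y → 𝟙 (invSeqVec v ≤* y))) ⟩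
  sumBy (λ v → sumBy (λ y → 𝟙 (invSeqVec v ≤* y)) (boundedSeqs 0 n)) (Sym n)
    ≡⟨ sumBy-Sym-invSeqVec n (λ x → sumBy (λ y → 𝟙 (x ≤* y)) (boundedSeqs 0 n)) ⟩
  comparablePairs 0 n ∎
  where open ≡-Reasoning

-- The identities also hold for n = 0.
corollary3p3 : (n : ℕ) → n ≥ 1 →
    (numIntervals n ≡ binomProduct n) × (2 ^ n * numIntervals n ≡ (n !) * (suc n !))
corollary3p3 n _ =
  trans numIntervals≡product (sym (binomProduct≡triangleProduct n)) ,
  trans (cong (2 ^ n *_) numIntervals≡product) (2^n*triangleProduct n)
  where
  numIntervals≡product : numIntervals n ≡ triangleProduct 0 n
  numIntervals≡product = trans (numIntervals≡comparablePairs n) (comparablePairs≡triangleProduct 0 n)
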